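{- Let $k>2$ be an integer and let $p,q$ be primes (possibly equal) with $p,q\notin\{2,3\}$ and $H(pq)=k$. Then $pq<2\cdot 3^{k-2}+1$.
   Context: Let $\varphi$ be Euler's totient function. The height function $H$ on positive integers is defined by $H(1)=0$ and $H(n)=H(\varphi(n))+1$ for $n\ge 2$. -}

module Defs where

open import Data.Nat using (ℕ; zero; suc; _+_)
open import Data.Nat.GCD using (gcd)
open import Data.List using (List; length; filter)
open import Data.List using (upTo)
open import Data.Nat using (_≟_)

φ : ℕ → ℕ
φ n = length (filter (λ i → gcd (suc i) n ≟ 1) (upTo n))

-- Since φ m < m for m ≥ 2, fuel n suffices
-- for every n ≥ 1, so H n = Hfuel n n is the paper's H on positive integers.
Hfuel : ℕ → ℕ → ℕ
Hfuel zero n = 0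
Hfuel (suc f) zero = 0
Hfuel (suc f) (suc zero) = 0
Hfuel (suc f) (suc (suc n)) = suc (Hfuel f (φ (suc (suc n))))

H : ℕ → ℕ
H n = Hfuel n n

{-# OPTIONS --safe #-}
-- Let C n be H n, lowered by one when n is odd and n > 1. Since φ (p * m) is p * φ m or
-- (p - 1) * φ m according as the prime p divides m or not, and φ n is even for n > 2, one
-- totient step reduces the additivity of C at (p, m) to its additivity at smaller arguments,
-- so C (a * b) = C a + C b for all positive a and b. Strong induction over factorisations
-- then gives 3 n ≤ 2 * 3 ^ C n for even n and n ≤ 3 ^ C n for all n ≥ 1, because
-- C (2 m) = 1 + C m and C p = C (p - 1) for odd primes p. For odd primes p, q ≥ 5 this means
-- H (p q) = 1 + C (p - 1) + C (q - 1) with p - 1 ≤ 2 * 3 ^ (C (p - 1) - 1), and multiplying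
-- out the two bounds gives p q ≤ 2 * 3 ^ (H (p q) - 2).
module Submission where

open import Defs
open import Data.Nat using (ℕ; _*_; _+_; _∸_; _^_; _<_)
open import Data.Nat.Primality using (Prime)
open import Relation.Binary.PropositionalEquality using (_≡_; _≢_)

open import Data.Bool using (Bool; true; false; _∧_; not)
open import Data.Bool.Properties using (∧-zeroʳ; ∧-identityʳ)
open import Data.Nat.ListAction using (product)
open import Data.List using ([]; _∷_; _∷ʳ_; _++_; length; filter; upTo)
open import Data.List.Properties using (upTo-∷ʳ; filter-++; length-++)
open import Data.List.Relation.Unary.All using (_∷_)
open import Data.Nat using (zero; suc; 2+; _≤_; z≤n; s≤s; z<s; _≟_; _≤?_; >-nonZero)
open import Data.Nat.Properties
open import Data.Nat.Divisibility
open import Data.Nat.GCD using (gcd)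
open import Data.Nat.Coprimality
  using (Coprime; coprime?; 1-coprimeTo; coprime-+; coprime-divisor) renaming (sym to coprime-sym)
open import Data.Nat.Primality
  using (prime[2]; ¬prime[1]; composite[4]; prime⇒¬composite; prime⇒irreducible; prime⇒nonZero; euclidsLemma; productOfPrimes≥1)
open import Data.Nat.Primality.Factorisation using (factorise)
open import Data.Nat.Induction using (<-rec)
open import Data.Nat.Tactic.RingSolver using (solve-∀)
open import Data.Product using (_×_; _,_; proj₁; proj₂; ∃-syntax)
open import Data.Empty using (⊥-elim)
open import Data.Sum using (inj₁; inj₂)
open import Function using (_∘_; _⇔_; mk⇔; Equivalence)
open import Relation.Nullary using (yes; no; does; ¬_; contradiction; ¬?; _×-dec_)
open import Relation.Nullary.Decidable using (dec-true; dec-false; does-⇔; from-no)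
open import Relation.Unary using (Pred; Decidable)
open import Algebra.Properties.CommutativeSemigroup +-commutativeSemigroup using (interchange)
open import Relation.Binary.PropositionalEquality using (refl; sym; trans; cong; cong₂; subst; module ≡-Reasoning)

-- Counting

fromBool : Bool → ℕ
fromBool true  = 1
fromBool false = 0

count : (ℕ → Bool) → ℕ → ℕ
count f zero    = 0
count f (suc n) = count f n + fromBool (f (suc n))

length-filter-[x] : ∀ {a p} {A : Set a} {P : Pred A p} (P? : Decidable P) x →
                    length (filter P? (x ∷ [])) ≡ fromBool (does (P? x))
length-filter-[x] P? x with does (P? x)
... | true  = refl
... | false = refl

length-filter-upTo : ∀ {p} {P : Pred ℕ p} (P? : Decidable P) n →
                     length (filter (P? ∘ suc) (upTo n)) ≡ count (does ∘ P?) n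
length-filter-upTo P? zero    = refl
length-filter-upTo P? (suc n) = begin
  length (filter (P? ∘ suc) (upTo (suc n)))   ≡⟨ cong (length ∘ filter (P? ∘ suc)) (upTo-∷ʳ n) ⟨
  length (filter (P? ∘ suc) (upTo n ∷ʳ n))    ≡⟨ cong length (filter-++ (P? ∘ suc) (upTo n) (n ∷ [])) ⟩
  length (filter (P? ∘ suc) (upTo n) ++ filter (P? ∘ suc) (n ∷ []))
    ≡⟨ length-++ (filter (P? ∘ suc) (upTo n)) ⟩
  length (filter (P? ∘ suc) (upTo n)) + length (filter (P? ∘ suc) (n ∷ []))
    ≡⟨ cong₂ _+_ (length-filter-upTo P? n) (length-filter-[x] (P? ∘ suc) n) ⟩
  count (does ∘ P?) (suc n)                   ∎
  where open ≡-Reasoning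

count-cong : ∀ {f g : ℕ → Bool} n → (∀ i → i < n → f (suc i) ≡ g (suc i)) → count f n ≡ count g n
count-cong zero    _   = refl
count-cong (suc n) f≗g =
  cong₂ _+_ (count-cong n (λ i i<n → f≗g i (m<n⇒m<1+n i<n))) (cong fromBool (f≗g n ≤-refl))

count-none : ∀ {f : ℕ → Bool} n → (∀ i → i < n → f (suc i) ≡ false) → count f n ≡ 0
count-none zero    _    = refl
count-none (suc n) none rewrite none n ≤-refl =
  trans (+-identityʳ _) (count-none n (λ i i<n → none i (m<n⇒m<1+n i<n)))

fromBool≤1 : ∀ b → fromBool b ≤ 1
fromBool≤1 true  = ≤-refl
fromBool≤1 false = z≤n

count≤ : ∀ (f : ℕ → Bool) n → count f n ≤ n
count≤ f zero    = z≤n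
count≤ f (suc n) = ≤-trans (+-mono-≤ (count≤ f n) (fromBool≤1 (f (suc n)))) (≤-reflexive (+-comm n 1))

count-+ : ∀ (f : ℕ → Bool) m n → count f (m + n) ≡ count f m + count (λ i → f (m + i)) n
count-+ f m zero    rewrite +-identityʳ m = sym (+-identityʳ _)
count-+ f m (suc n) rewrite +-suc m n =
  trans (cong (_+ fromBool (f (suc (m + n)))) (count-+ f m n)) (+-assoc (count f m) _ _)

count-periodic : ∀ (f : ℕ → Bool) m → (∀ i → f (m + i) ≡ f i) → ∀ k → count f (k * m) ≡ k * count f m
count-periodic f m periodic zero    = refl
count-periodic f m periodic (suc k) = begin
  count f (m + k * m)                          ≡⟨ count-+ f m (k * m) ⟩
  count f m + count (λ i → f (m + i)) (k * m)  ≡⟨ cong (count f m +_) (count-cong (k * m) (λ i _ → periodic (suc i))) ⟩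
  count f m + count f (k * m)                  ≡⟨ cong (count f m +_) (count-periodic f m periodic k) ⟩
  count f m + k * count f m                    ∎
  where open ≡-Reasoning

fromBool-∧-not+fromBool-∧ : ∀ x y → fromBool (x ∧ not y) + fromBool (x ∧ y) ≡ fromBool x
fromBool-∧-not+fromBool-∧ true  true  = refl
fromBool-∧-not+fromBool-∧ true  false = refl
fromBool-∧-not+fromBool-∧ false _     = refl

count-∧-not+count-∧ : ∀ (f g : ℕ → Bool) n → count (λ i → f i ∧ not (g i)) n + count (λ i → f i ∧ g i) n ≡ count f n
count-∧-not+count-∧ f g zero    = refl
count-∧-not+count-∧ f g (suc n) =
  trans (interchange (count (λ i → f i ∧ not (g i)) n) (fromBool (f (suc n) ∧ not (g (suc n))))
                     (count (λ i → f i ∧ g i) n) (fromBool (f (suc n) ∧ g (suc n))))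
        (cong₂ _+_ (count-∧-not+count-∧ f g n) (fromBool-∧-not+fromBool-∧ (f (suc n)) (g (suc n))))

count-multiples : ∀ {p} (f : ℕ → Bool) m → 0 < p → count (λ i → f i ∧ does (p ∣? i)) (p * m) ≡ count (λ t → f (p * t)) m
count-multiples {p} f zero    _   rewrite *-zeroʳ p = refl
count-multiples {p@(suc p′)} f (suc m) 0<p = begin
  count g (p * suc m)                             ≡⟨ cong (count g) (trans (*-suc p m) (+-comm p (p * m))) ⟩
  count g (p * m + p)                             ≡⟨ count-+ g (p * m) p ⟩
  count g (p * m) + count (λ j → g (p * m + j)) p ≡⟨ cong₂ _+_ (count-multiples f m 0<p) one-multiple-per-period ⟩
  count (λ t → f (p * t)) m + fromBool (f (p * suc m)) ∎
  where
  open ≡-Reasoning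
  g : ℕ → Bool
  g i = f i ∧ does (p ∣? i)
  one-multiple-per-period : count (λ j → g (p * m + j)) p ≡ fromBool (f (p * suc m))
  one-multiple-per-period = cong₂ _+_ (count-none p′ none) (cong fromBool last)
    where
    none : ∀ i → i < p′ → g (p * m + suc i) ≡ false
    none i i<p′ = trans (cong (f (p * m + suc i) ∧_) (dec-false (p ∣? _) p∤)) (∧-zeroʳ _)
      where
      p∤ : ¬ p ∣ p * m + suc i
      p∤ p∣ = <⇒≱ (s≤s i<p′) (∣⇒≤ (∣m+n∣m⇒∣n p∣ (m∣m*n m)))
    last : g (p * m + p) ≡ f (p * suc m)
    last = trans (cong (f (p * m + p) ∧_) (dec-true (p ∣? _) (∣m∣n⇒∣m+n (m∣m*n m) ∣-refl)))
                 (trans (∧-identityʳ _) (cong f (trans (+-comm (p * m) p) (sym (*-suc p m)))))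

-- Primes and parity

prime≢1 : ∀ {p} → Prime p → p ≢ 1
prime≢1 p-prime refl = ¬prime[1] p-prime

prime⇒1< : ∀ {p} → Prime p → 1 < p
prime⇒1< {2+ _} _ = s≤s (s≤s z≤n)

prime⇒0< : ∀ {p} → Prime p → 0 < p
prime⇒0< p-prime = <-trans z<s (prime⇒1< p-prime)

m<p*m : ∀ {p m} → Prime p → 0 < m → m < p * m
m<p*m {p} {m} p-prime 0<m = subst (m <_) (*-comm m p) (m<m*n m p {{>-nonZero 0<m}} (prime⇒1< p-prime))

1<p*m : ∀ {p m} → 0 < p → 1 < m → 1 < p * m
1<p*m {p} {m} 0<p 1<m = <-≤-trans 1<m (m≤n*m m p {{>-nonZero 0<p}})

prime-factor : ∀ n → 1 < n → ∃[ p ] ∃[ m ] Prime p × 0 < m × n ≡ p * m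
prime-factor n@(suc _) 1<n with factorise n
... | record { factors = [] ; isFactorisation = n≡1 } = contradiction (sym n≡1) (<⇒≢ 1<n)
... | record { factors = p ∷ ps ; isFactorisation = n≡p*ps ; factorsPrime = p-prime ∷ ps-prime } =
  p , product ps , p-prime , productOfPrimes≥1 ps-prime , n≡p*ps

2∤suc⇒2∣ : ∀ n → ¬ 2 ∣ suc n → 2 ∣ n
2∤suc⇒2∣ zero          _    = 2 ∣0
2∤suc⇒2∣ (suc zero)    2∤2  = contradiction ∣-refl 2∤2
2∤suc⇒2∣ (suc (suc n)) 2∤n+3 = ∣m∣n⇒∣m+n ∣-refl (2∤suc⇒2∣ n (2∤n+3 ∘ ∣m∣n⇒∣m+n ∣-refl))

2∤⇒2∣pred : ∀ {n} → ¬ 2 ∣ n → 2 ∣ n ∸ 1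
2∤⇒2∣pred {zero}  2∤0 = contradiction (2 ∣0) 2∤0
2∤⇒2∣pred {suc n} 2∤n = 2∤suc⇒2∣ n 2∤n

2∤* : ∀ {m n} → ¬ 2 ∣ m → ¬ 2 ∣ n → ¬ 2 ∣ m * n
2∤* {m} {n} 2∤m 2∤n 2∣mn with euclidsLemma m n prime[2] 2∣mn
... | inj₁ 2∣m = 2∤m 2∣m
... | inj₂ 2∣n = 2∤n 2∣n

prime≢2⇒2∤ : ∀ {p} → Prime p → p ≢ 2 → ¬ 2 ∣ p
prime≢2⇒2∤ p-prime p≢2 2∣p with prime⇒irreducible p-prime 2∣p
... | inj₁ ()
... | inj₂ 2≡p = p≢2 (sym 2≡p)

prime≢2⇒2< : ∀ {p} → Prime p → p ≢ 2 → 2 < p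
prime≢2⇒2< {2}           _ 2≢2 = contradiction refl 2≢2
prime≢2⇒2< {suc (2+ _)} _ _   = s≤s (s≤s (s≤s z≤n))

prime≢2,3⇒4< : ∀ {p} → Prime p → p ≢ 2 → p ≢ 3 → 4 < p
prime≢2,3⇒4< {2}                 _       2≢2 _   = contradiction refl 2≢2
prime≢2,3⇒4< {3}                 _       _   3≢3 = contradiction refl 3≢3
prime≢2,3⇒4< {4}                 4-prime _   _   = contradiction composite[4] (prime⇒¬composite 4-prime)
prime≢2,3⇒4< {suc (suc (2+ (suc _)))} _ _ _ = s≤s (s≤s (s≤s (s≤s (s≤s z≤n))))

-- Coprimality

coprime-∣ˡ : ∀ {d m n} → d ∣ m → Coprime m n → Coprime d n
coprime-∣ˡ d∣m c (e∣d , e∣n) = c (∣-trans e∣d d∣m , e∣n)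

coprime-+ˡ-⇔ : ∀ {i m} → Coprime (m + i) m ⇔ Coprime i m
coprime-+ˡ-⇔ {i} {m} = mk⇔ to coprime-+
  where
  to : Coprime (m + i) m → Coprime i m
  to c (d∣i , d∣m) = c (∣m∣n⇒∣m+n d∣m d∣i , d∣m)

coprime-*ˡ-⇔ : ∀ {p t m} → Coprime p m → Coprime (p * t) m ⇔ Coprime t m
coprime-*ˡ-⇔ {p} {t} {m} p⊥m = mk⇔ to from
  where
  to : Coprime (p * t) m → Coprime t m
  to c (d∣t , d∣m) = c (∣n⇒∣m*n p d∣t , d∣m)
  from : Coprime t m → Coprime (p * t) m
  from c (d∣pt , d∣m) = c (coprime-divisor (coprime-∣ˡ d∣m (coprime-sym p⊥m)) d∣pt , d∣m)

prime∤⇒coprime : ∀ {p i} → Prime p → ¬ p ∣ i → Coprime p i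
prime∤⇒coprime p-prime p∤i (d∣p , d∣i) with prime⇒irreducible p-prime d∣p
... | inj₁ d≡1 = d≡1
... | inj₂ refl = contradiction d∣i p∤i

coprime-*-prime-⇔ : ∀ {p m i} → Prime p → Coprime i (p * m) ⇔ (Coprime i m × ¬ p ∣ i)
coprime-*-prime-⇔ {p} {m} {i} p-prime = mk⇔ to from
  where
  to : Coprime i (p * m) → Coprime i m × ¬ p ∣ i
  to c = (λ (d∣i , d∣m) → c (d∣i , ∣n⇒∣m*n p d∣m)) , (λ p∣i → prime≢1 p-prime (c (p∣i , m∣m*n m)))
  from : Coprime i m × ¬ p ∣ i → Coprime i (p * m)
  from (c , p∤i) (d∣i , d∣pm) =
    c (d∣i , coprime-divisor (coprime-∣ˡ d∣i (coprime-sym (prime∤⇒coprime p-prime p∤i))) d∣pm)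

coprime-*-∣-⇔ : ∀ {p m i} → Prime p → p ∣ m → Coprime i (p * m) ⇔ Coprime i m
coprime-*-∣-⇔ {p} {m} {i} p-prime p∣m = mk⇔ (proj₁ ∘ to) (λ c → from (c , p∤i c))
  where
  open Equivalence (coprime-*-prime-⇔ {p} {m} {i} p-prime)
  p∤i : Coprime i m → ¬ p ∣ i
  p∤i c p∣i = prime≢1 p-prime (c (p∣i , p∣m))

-- Euler's totient

coprimeTo : ℕ → ℕ → Bool
coprimeTo n i = does (coprime? i n)

-- does (coprime? i n) unfolds to does (gcd i n ≟ 1), the test used in the definition of φ.
φ≡count-coprimeTo : ∀ n → φ n ≡ count (coprimeTo n) n
φ≡count-coprimeTo n = length-filter-upTo (λ i → gcd i n ≟ 1) n

count-coprimeTo-* : ∀ k m → count (coprimeTo m) (k * m) ≡ k * φ m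
count-coprimeTo-* k m = begin
  count (coprimeTo m) (k * m) ≡⟨ count-periodic (coprimeTo m) m periodic k ⟩
  k * count (coprimeTo m) m   ≡⟨ cong (k *_) (φ≡count-coprimeTo m) ⟨
  k * φ m                     ∎
  where
  open ≡-Reasoning
  periodic : ∀ i → coprimeTo m (m + i) ≡ coprimeTo m i
  periodic i = does-⇔ coprime-+ˡ-⇔ (coprime? (m + i) m) (coprime? i m)

φ-*-∣ : ∀ {p m} → Prime p → p ∣ m → φ (p * m) ≡ p * φ m
φ-*-∣ {p} {m} p-prime p∣m = begin
  φ (p * m)                         ≡⟨ φ≡count-coprimeTo (p * m) ⟩
  count (coprimeTo (p * m)) (p * m) ≡⟨ count-cong (p * m) (λ i _ →
                                         does-⇔ (coprime-*-∣-⇔ p-prime p∣m) (coprime? (suc i) (p * m)) (coprime? (suc i) m)) ⟩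
  count (coprimeTo m) (p * m)       ≡⟨ count-coprimeTo-* p m ⟩
  p * φ m                           ∎
  where open ≡-Reasoning

φ-*-∤ : ∀ {p m} → Prime p → ¬ p ∣ m → φ (p * m) ≡ (p ∸ 1) * φ m
φ-*-∤ {p} {m} p-prime p∤m = +-cancelʳ-≡ (φ m) _ _ (begin
  φ (p * m) + φ m
    ≡⟨ cong₂ _+_ coprime-to-p*m multiples-of-p ⟩
  count (λ i → coprimeTo m i ∧ not (does (p ∣? i))) (p * m) + count (λ i → coprimeTo m i ∧ does (p ∣? i)) (p * m)
    ≡⟨ count-∧-not+count-∧ (coprimeTo m) (λ i → does (p ∣? i)) (p * m) ⟩
  count (coprimeTo m) (p * m)
    ≡⟨ count-coprimeTo-* p m ⟩
  p * φ m
    ≡⟨ cong (_* φ m) (suc-pred p {{prime⇒nonZero p-prime}}) ⟨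
  φ m + (p ∸ 1) * φ m
    ≡⟨ +-comm (φ m) _ ⟩
  (p ∸ 1) * φ m + φ m ∎)
  where
  open ≡-Reasoning
  coprime-to-p*m : φ (p * m) ≡ count (λ i → coprimeTo m i ∧ not (does (p ∣? i))) (p * m)
  coprime-to-p*m = trans (φ≡count-coprimeTo (p * m)) (count-cong (p * m) (λ i _ →
    does-⇔ (coprime-*-prime-⇔ p-prime) (coprime? (suc i) (p * m)) (coprime? (suc i) m ×-dec ¬? (p ∣? suc i))))
  multiples-of-p : φ m ≡ count (λ i → coprimeTo m i ∧ does (p ∣? i)) (p * m)
  multiples-of-p = sym (begin
    count (λ i → coprimeTo m i ∧ does (p ∣? i)) (p * m)
      ≡⟨ count-multiples (coprimeTo m) m (prime⇒0< p-prime) ⟩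
    count (λ t → coprimeTo m (p * t)) m
      ≡⟨ count-cong m (λ t _ →
           does-⇔ (coprime-*ˡ-⇔ (prime∤⇒coprime p-prime p∤m)) (coprime? (p * suc t) m) (coprime? (suc t) m)) ⟩
    count (coprimeTo m) m
      ≡⟨ φ≡count-coprimeTo m ⟨
    φ m ∎)

φ-prime : ∀ {p} → Prime p → φ p ≡ p ∸ 1
φ-prime {p} p-prime = begin
  φ p         ≡⟨ cong φ (*-identityʳ p) ⟨
  φ (p * 1)   ≡⟨ φ-*-∤ p-prime (prime≢1 p-prime ∘ ∣1⇒≡1) ⟩
  (p ∸ 1) * 1 ≡⟨ *-identityʳ (p ∸ 1) ⟩
  p ∸ 1       ∎
  where open ≡-Reasoning

φ≤ : ∀ n → φ n ≤ n
φ≤ n = subst (_≤ n) (sym (φ≡count-coprimeTo n)) (count≤ (coprimeTo n) n)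

φ< : ∀ n → 1 < n → φ n < n
φ< n@(suc n′) 1<n = subst (_< n) (sym (φ≡count-coprimeTo n)) (begin-strict
  count (coprimeTo n) n′ + fromBool (coprimeTo n n) ≡⟨ cong ((count (coprimeTo n) n′ +_) ∘ fromBool) n⊥̸n-false ⟩
  count (coprimeTo n) n′ + 0                        ≡⟨ +-identityʳ _ ⟩
  count (coprimeTo n) n′                            ≤⟨ count≤ (coprimeTo n) n′ ⟩
  n′                                                <⟨ n<1+n n′ ⟩
  n                                                 ∎)
  where
  open ≤-Reasoning
  n⊥̸n-false : coprimeTo n n ≡ false
  n⊥̸n-false = dec-false (coprime? n n) (λ c → <⇒≢ 1<n (sym (c (∣-refl , ∣-refl))))

φ-pos : ∀ n → 0 < n → 0 < φ n
φ-pos n@(suc n′) _ = subst (0 <_) (sym (φ≡count-coprimeTo n)) (begin-strict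
  0                                                            <⟨ z<s ⟩
  fromBool true                                                ≡⟨ cong fromBool (dec-true (coprime? 1 n) (1-coprimeTo n)) ⟨
  count (coprimeTo n) 1                                        ≤⟨ m≤m+n _ _ ⟩
  count (coprimeTo n) 1 + count (λ i → coprimeTo n (1 + i)) n′ ≡⟨ count-+ (coprimeTo n) 1 n′ ⟨
  count (coprimeTo n) n                                        ∎)
  where open ≤-Reasoning

2∣φ : ∀ n → 2 < n → 2 ∣ φ n
2∣φ = <-rec (λ n → 2 < n → 2 ∣ φ n) step
  where
  step : ∀ n → (∀ {m} → m < n → 2 < m → 2 ∣ φ m) → 2 < n → 2 ∣ φ n
  step n rec 2<n with prime-factor n (≤-trans (n≤1+n 2) 2<n)
  ... | p , m , p-prime , 0<m , refl with p ∣? m | p ≟ 2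
  ... | yes p∣m | yes refl rewrite φ-*-∣ p-prime p∣m = m∣m*n (φ m)
  ... | yes p∣m | no p≢2   rewrite φ-*-∣ p-prime p∣m =
    ∣n⇒∣m*n p (rec (m<p*m p-prime 0<m) (<-≤-trans (prime≢2⇒2< p-prime p≢2) (∣⇒≤ {{>-nonZero 0<m}} p∣m)))
  ... | no p∤m  | yes refl rewrite φ-*-∤ p-prime p∤m =
    ∣n⇒∣m*n 1 (rec (m<p*m p-prime 0<m) (2<2*m⇒2∤m⇒2<m m 2<n p∤m))
    where
    2<2*m⇒2∤m⇒2<m : ∀ m → 2 < 2 * m → ¬ 2 ∣ m → 2 < m
    2<2*m⇒2∤m⇒2<m (suc zero)      (s≤s (s≤s ())) _
    2<2*m⇒2∤m⇒2<m (suc (suc zero)) _  2∤2 = contradiction ∣-refl 2∤2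
    2<2*m⇒2∤m⇒2<m (suc (2+ _))    _  _   = s≤s (s≤s (s≤s z≤n))
  ... | no p∤m  | no p≢2   rewrite φ-*-∤ p-prime p∤m =
    ∣m⇒∣m*n (φ m) (2∤⇒2∣pred (prime≢2⇒2∤ p-prime p≢2))

-- The height and its completely additive correction

Hfuel-irrelevant : ∀ f g n → n ≤ f → n ≤ g → Hfuel f n ≡ Hfuel g n
Hfuel-irrelevant zero    zero    _        _         _         = refl
Hfuel-irrelevant zero    (suc _) zero     _         _         = refl
Hfuel-irrelevant (suc _) zero    zero     _         _         = refl
Hfuel-irrelevant (suc _) (suc _) zero     _         _         = refl
Hfuel-irrelevant (suc _) (suc _) 1        _         _         = refl
Hfuel-irrelevant (suc f) (suc g) n@(2+ _) n≤1+f     n≤1+g     =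
  cong suc (Hfuel-irrelevant f g (φ n) (φn≤ n≤1+f) (φn≤ n≤1+g))
  where
  φn≤ : ∀ {h} → n ≤ suc h → φ n ≤ h
  φn≤ n≤1+h = ≤-pred (≤-trans (φ< n (s≤s (s≤s z≤n))) n≤1+h)

H-step : ∀ n → 1 < n → H n ≡ suc (H (φ n))
H-step 1        (s≤s ())
H-step n@(2+ k) _ = cong suc (Hfuel-irrelevant (suc k) (φ n) (φ n) (≤-pred (φ< n (s≤s (s≤s z≤n)))) ≤-refl)

[odd>1] : ℕ → ℕ
[odd>1] 1 = 0
[odd>1] n = fromBool (not (does (2 ∣? n)))

[odd>1]≤1 : ∀ n → [odd>1] n ≤ 1
[odd>1]≤1 1 = z≤n
[odd>1]≤1 zero = z≤n
[odd>1]≤1 n@(2+ _) = fromBool≤1 (not (does (2 ∣? n)))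

[odd>1]-even : ∀ {n} → 2 ∣ n → [odd>1] n ≡ 0
[odd>1]-even {zero}     _   = refl
[odd>1]-even {1}        _   = refl
[odd>1]-even {n@(2+ _)} 2∣n = cong (fromBool ∘ not) (dec-true (2 ∣? n) 2∣n)

[odd>1]-odd : ∀ {n} → 1 < n → ¬ 2 ∣ n → [odd>1] n ≡ 1
[odd>1]-odd {1}        (s≤s ()) _
[odd>1]-odd {n@(2+ _)} _        2∤n = cong (fromBool ∘ not) (dec-false (2 ∣? n) 2∤n)

[odd>1]-φ : ∀ n → [odd>1] (φ n) ≡ 0
[odd>1]-φ 0          = refl
[odd>1]-φ 1          = refl
[odd>1]-φ 2          = refl
[odd>1]-φ n@(suc (2+ _)) = [odd>1]-even (2∣φ n (s≤s (s≤s (s≤s z≤n))))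

[odd>1]-*-odd : ∀ {p m} → ¬ 2 ∣ p → 0 < p → 1 < m → [odd>1] (p * m) ≡ [odd>1] m
[odd>1]-*-odd {p} {m} 2∤p 0<p 1<m with 2 ∣? m
... | yes 2∣m = trans ([odd>1]-even (∣n⇒∣m*n p 2∣m)) (sym ([odd>1]-even 2∣m))
... | no  2∤m = trans ([odd>1]-odd (1<p*m 0<p 1<m) (2∤* 2∤p 2∤m)) (sym ([odd>1]-odd 1<m 2∤m))

[odd>1]-*-∣ : ∀ {p m} → Prime p → p ∣ m → 1 < m → [odd>1] (p * m) ≡ [odd>1] m
[odd>1]-*-∣ {p} {m} p-prime p∣m 1<m with p ≟ 2
... | yes refl = trans ([odd>1]-even (m∣m*n m)) (sym ([odd>1]-even p∣m))
... | no  p≢2  = [odd>1]-*-odd (prime≢2⇒2∤ p-prime p≢2) (prime⇒0< p-prime) 1<m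

[odd>1]-*-∤ : ∀ {p m} → Prime p → ¬ p ∣ m → 1 < m → [odd>1] p + [odd>1] m ≡ suc ([odd>1] (p * m))
[odd>1]-*-∤ {p} {m} p-prime p∤m 1<m with p ≟ 2
... | yes refl rewrite [odd>1]-odd 1<m p∤m | [odd>1]-even (m∣m*n {2} m) = refl
... | no  p≢2  rewrite [odd>1]-odd (prime⇒1< p-prime) (prime≢2⇒2∤ p-prime p≢2) =
  cong suc (sym ([odd>1]-*-odd (prime≢2⇒2∤ p-prime p≢2) (prime⇒0< p-prime) 1<m))

C : ℕ → ℕ
C n = H n ∸ [odd>1] n

C+[odd>1]≡H : ∀ n → C n + [odd>1] n ≡ H n
C+[odd>1]≡H n = m∸n+n≡m ([odd>1]≤H n)
  where
  [odd>1]≤H : ∀ n → [odd>1] n ≤ H n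
  [odd>1]≤H 0          = z≤n
  [odd>1]≤H 1          = z≤n
  [odd>1]≤H n@(2+ _)   = ≤-trans ([odd>1]≤1 n) (s≤s z≤n)

C-step : ∀ n → 1 < n → C n + [odd>1] n ≡ suc (C (φ n))
C-step n 1<n = begin
  C n + [odd>1] n               ≡⟨ C+[odd>1]≡H n ⟩
  H n                           ≡⟨ H-step n 1<n ⟩
  suc (H (φ n))                 ≡⟨ cong suc (C+[odd>1]≡H (φ n)) ⟨
  suc (C (φ n) + [odd>1] (φ n)) ≡⟨ cong (λ x → suc (C (φ n) + x)) ([odd>1]-φ n) ⟩
  suc (C (φ n) + 0)             ≡⟨ cong suc (+-identityʳ (C (φ n))) ⟩
  suc (C (φ n))                 ∎
  where open ≡-Reasoning

C-prime-step : ∀ {p} → Prime p → C p + [odd>1] p ≡ suc (C (p ∸ 1))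
C-prime-step {p} p-prime = trans (C-step p (prime⇒1< p-prime)) (cong (suc ∘ C) (φ-prime p-prime))

C-odd-prime : ∀ {p} → Prime p → p ≢ 2 → C p ≡ C (p ∸ 1)
C-odd-prime {p} p-prime p≢2 = suc-injective (begin
  suc (C p)       ≡⟨ +-comm 1 (C p) ⟩
  C p + 1         ≡⟨ cong (C p +_) ([odd>1]-odd (prime⇒1< p-prime) (prime≢2⇒2∤ p-prime p≢2)) ⟨
  C p + [odd>1] p ≡⟨ C-prime-step p-prime ⟩
  suc (C (p ∸ 1)) ∎)
  where open ≡-Reasoning

C-*-∣ : ∀ {p m} → Prime p → p ∣ m → 1 < m →
        C (p * φ m) ≡ C p + C (φ m) → C (p * m) ≡ C p + C m
C-*-∣ {p} {m} p-prime p∣m 1<m additive = +-cancelʳ-≡ ([odd>1] m) _ _ (begin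
  C (p * m) + [odd>1] m       ≡⟨ cong (C (p * m) +_) ([odd>1]-*-∣ p-prime p∣m 1<m) ⟨
  C (p * m) + [odd>1] (p * m) ≡⟨ C-step (p * m) (1<p*m (prime⇒0< p-prime) 1<m) ⟩
  suc (C (φ (p * m)))         ≡⟨ cong (suc ∘ C) (φ-*-∣ p-prime p∣m) ⟩
  suc (C (p * φ m))           ≡⟨ cong suc additive ⟩
  suc (C p + C (φ m))         ≡⟨ +-suc (C p) (C (φ m)) ⟨
  C p + suc (C (φ m))         ≡⟨ cong (C p +_) (C-step m 1<m) ⟨
  C p + (C m + [odd>1] m)     ≡⟨ +-assoc (C p) (C m) ([odd>1] m) ⟨
  C p + C m + [odd>1] m       ∎)
  where open ≡-Reasoning

C-*-∤ : ∀ {p m} → Prime p → ¬ p ∣ m → 1 < m →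
        C ((p ∸ 1) * φ m) ≡ C (p ∸ 1) + C (φ m) → C (p * m) ≡ C p + C m
C-*-∤ {p} {m} p-prime p∤m 1<m additive = +-cancelʳ-≡ (suc ([odd>1] (p * m))) _ _ (begin
  C (p * m) + suc ([odd>1] (p * m))   ≡⟨ +-suc (C (p * m)) ([odd>1] (p * m)) ⟩
  suc (C (p * m) + [odd>1] (p * m))   ≡⟨ cong suc (C-step (p * m) (1<p*m (prime⇒0< p-prime) 1<m)) ⟩
  suc (suc (C (φ (p * m))))           ≡⟨ cong (suc ∘ suc ∘ C) (φ-*-∤ p-prime p∤m) ⟩
  suc (suc (C ((p ∸ 1) * φ m)))       ≡⟨ cong (suc ∘ suc) additive ⟩
  suc (suc (C (p ∸ 1) + C (φ m)))     ≡⟨ cong suc (+-suc (C (p ∸ 1)) (C (φ m))) ⟨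
  suc (C (p ∸ 1)) + suc (C (φ m))     ≡⟨ cong₂ _+_ (C-prime-step p-prime) (C-step m 1<m) ⟨
  (C p + [odd>1] p) + (C m + [odd>1] m) ≡⟨ interchange (C p) ([odd>1] p) (C m) ([odd>1] m) ⟩
  (C p + C m) + ([odd>1] p + [odd>1] m) ≡⟨ cong (C p + C m +_) ([odd>1]-*-∤ p-prime p∤m 1<m) ⟩
  C p + C m + suc ([odd>1] (p * m))   ∎)
  where open ≡-Reasoning

AdditiveBelow : ℕ → Set
AdditiveBelow n = ∀ a b → 0 < a → 0 < b → a * b < n → C (a * b) ≡ C a + C b

p*φ[m]<p*m : ∀ {p m} → Prime p → 1 < m → p * φ m < p * m
p*φ[m]<p*m {p} {m} p-prime 1<m = *-monoʳ-< p {{prime⇒nonZero p-prime}} (φ< m 1<m)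

[p∸1]*φ[m]<p*m : ∀ {p m} → Prime p → 0 < m → (p ∸ 1) * φ m < p * m
[p∸1]*φ[m]<p*m {p} {m} p-prime 0<m = begin-strict
  (p ∸ 1) * φ m ≤⟨ *-monoʳ-≤ (p ∸ 1) (φ≤ m) ⟩
  (p ∸ 1) * m   <⟨ *-monoˡ-< m {{>-nonZero 0<m}} (∸-monoʳ-< z<s (prime⇒0< p-prime)) ⟩
  p * m         ∎
  where open ≤-Reasoning

C-*-prime : ∀ {p m} → Prime p → 0 < m → AdditiveBelow (p * m) → C (p * m) ≡ C p + C m
C-*-prime {p} {1}        _       _   _     = trans (cong C (*-identityʳ p)) (sym (+-identityʳ (C p)))
C-*-prime {p} {m@(2+ _)} p-prime 0<m below with p ∣? m
... | yes p∣m = C-*-∣ p-prime p∣m (s≤s (s≤s z≤n))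
  (below p (φ m) (prime⇒0< p-prime) (φ-pos m 0<m) (p*φ[m]<p*m p-prime (s≤s (s≤s z≤n))))
... | no  p∤m = C-*-∤ p-prime p∤m (s≤s (s≤s z≤n))
  (below (p ∸ 1) (φ m) (∸-monoˡ-< (prime⇒1< p-prime) ≤-refl) (φ-pos m 0<m) ([p∸1]*φ[m]<p*m p-prime 0<m))

C-*-prime-multiple : ∀ {p a b} → Prime p → 0 < a → 0 < b → AdditiveBelow (p * a * b) → C (p * a * b) ≡ C (p * a) + C b
C-*-prime-multiple {p} {a} {b} p-prime 0<a 0<b below = begin
  C (p * a * b)     ≡⟨ cong C (*-assoc p a b) ⟩
  C (p * (a * b))   ≡⟨ C-*-prime p-prime 0<a*b (subst AdditiveBelow (*-assoc p a b) below) ⟩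
  C p + C (a * b)   ≡⟨ cong (C p +_) (below a b 0<a 0<b a*b<p*a*b) ⟩
  C p + (C a + C b) ≡⟨ +-assoc (C p) (C a) (C b) ⟨
  C p + C a + C b   ≡⟨ cong (_+ C b) (C-*-prime p-prime 0<a below-p*a) ⟨
  C (p * a) + C b   ∎
  where
  open ≡-Reasoning
  0<a*b : 0 < a * b
  0<a*b = *-mono-≤ 0<a 0<b
  a*b<p*a*b : a * b < p * a * b
  a*b<p*a*b = subst (a * b <_) (sym (*-assoc p a b)) (m<p*m p-prime 0<a*b)
  below-p*a : AdditiveBelow (p * a)
  below-p*a x y 0<x 0<y x*y<p*a = below x y 0<x 0<y (<-≤-trans x*y<p*a (m≤m*n (p * a) b {{>-nonZero 0<b}}))

C-* : ∀ a b → 0 < a → 0 < b → C (a * b) ≡ C a + C b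
C-* a b 0<a 0<b = <-rec P step (a * b) a b 0<a 0<b refl
  where
  P : ℕ → Set
  P n = ∀ a b → 0 < a → 0 < b → a * b ≡ n → C (a * b) ≡ C a + C b
  step : ∀ n → (∀ {m} → m < n → P m) → P n
  step _ _   1        b _ _   _    = cong C (*-identityˡ b)
  step _ rec a@(2+ _) b _ 0<b refl with prime-factor a (s≤s (s≤s z≤n))
  ... | p , a′ , p-prime , 0<a′ , a≡p*a′ =
    subst (λ a → C (a * b) ≡ C a + C b) (sym a≡p*a′) (C-*-prime-multiple p-prime 0<a′ 0<b below)
    where
    below : AdditiveBelow (p * a′ * b)
    below x y 0<x 0<y x*y<p*a′*b =
      rec (subst (x * y <_) (cong (_* b) (sym a≡p*a′)) x*y<p*a′*b) x y 0<x 0<y refl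

-- Bounds

3*≤2*⇒≤ : ∀ {n x} → 3 * n ≤ 2 * x → n ≤ x
3*≤2*⇒≤ {n} {x} 3n≤2x = *-cancelˡ-≤ 3 (≤-trans 3n≤2x (*-monoˡ-≤ x (n≤1+n 2)))

3*≤2*3^⇒<3^ : ∀ {x} c → 0 < x → 3 * x ≤ 2 * 3 ^ c → x < 3 ^ c
3*≤2*3^⇒<3^ zero    0<x 3x≤2 = contradiction (≤-trans (*-monoʳ-≤ 3 0<x) 3x≤2) (from-no (3 ≤? 2))
3*≤2*3^⇒<3^ {x} (suc c) _ 3x≤6*3^c = begin-strict
  x             ≤⟨ *-cancelˡ-≤ 3 (≤-trans 3x≤6*3^c (≤-reflexive (2*[3*y]≡3*[2*y] (3 ^ c)))) ⟩
  2 * 3 ^ c     <⟨ m<m+n (2 * 3 ^ c) (m^n>0 3 c) ⟩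
  2 * 3 ^ c + 3 ^ c ≡⟨ +-comm (2 * 3 ^ c) (3 ^ c) ⟩
  3 * 3 ^ c     ∎
  where
  open ≤-Reasoning
  2*[3*y]≡3*[2*y] : ∀ y → 2 * (3 * y) ≡ 3 * (2 * y)
  2*[3*y]≡3*[2*y] = solve-∀

3*[2*m]≤2*3^C : ∀ {m} → 0 < m → m ≤ 3 ^ C m → 3 * (2 * m) ≤ 2 * 3 ^ C (2 * m)
3*[2*m]≤2*3^C {m} 0<m m≤3^C = begin
  3 * (2 * m)       ≡⟨ 3*[2*m]≡2*[3*m] m ⟩
  2 * (3 * m)       ≤⟨ *-monoʳ-≤ 2 (*-monoʳ-≤ 3 m≤3^C) ⟩
  2 * 3 ^ suc (C m) ≡⟨ cong (λ c → 2 * 3 ^ c) (C-* 2 m z<s 0<m) ⟨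
  2 * 3 ^ C (2 * m) ∎
  where
  open ≤-Reasoning
  3*[2*m]≡2*[3*m] : ∀ m → 3 * (2 * m) ≡ 2 * (3 * m)
  3*[2*m]≡2*[3*m] = solve-∀

p*m≤3^C : ∀ {p m} → Prime p → p ≢ 2 → 0 < m →
          3 * (p ∸ 1) ≤ 2 * 3 ^ C (p ∸ 1) → m ≤ 3 ^ C m → p * m ≤ 3 ^ C (p * m)
p*m≤3^C {p} {m} p-prime p≢2 0<m 3[p-1]≤ m≤3^C = begin
  p * m                 ≤⟨ *-mono-≤ p≤3^C m≤3^C ⟩
  3 ^ C p * 3 ^ C m     ≡⟨ ^-distribˡ-+-* 3 (C p) (C m) ⟨
  3 ^ (C p + C m)       ≡⟨ cong (3 ^_) (C-* p m (prime⇒0< p-prime) 0<m) ⟨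
  3 ^ C (p * m)         ∎
  where
  open ≤-Reasoning
  p≤3^C : p ≤ 3 ^ C p
  p≤3^C = begin
    p                 ≡⟨ suc-pred p {{prime⇒nonZero p-prime}} ⟨
    suc (p ∸ 1)       ≤⟨ 3*≤2*3^⇒<3^ (C (p ∸ 1)) (∸-monoˡ-< (prime⇒1< p-prime) ≤-refl) 3[p-1]≤ ⟩
    3 ^ C (p ∸ 1)     ≡⟨ cong (3 ^_) (C-odd-prime p-prime p≢2) ⟨
    3 ^ C p           ∎

3^C-bounds : ∀ n → 0 < n → (2 ∣ n → 3 * n ≤ 2 * 3 ^ C n) × n ≤ 3 ^ C n
3^C-bounds = <-rec P step
  where
  P : ℕ → Set
  P n = 0 < n → (2 ∣ n → 3 * n ≤ 2 * 3 ^ C n) × n ≤ 3 ^ C n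
  step : ∀ n → (∀ {m} → m < n → P m) → P n
  step n rec 0<n with 2 ∣? n
  ... | yes (divides m n≡m*2) = (λ _ → even) , 3*≤2*⇒≤ even
    where
    n≡2*m : n ≡ 2 * m
    n≡2*m = trans n≡m*2 (*-comm m 2)
    0<m : 0 < m
    0<m = n≢0⇒n>0 (λ m≡0 → <⇒≢ 0<n (sym (trans n≡2*m (cong (2 *_) m≡0))))
    even : 3 * n ≤ 2 * 3 ^ C n
    even = subst (λ n → 3 * n ≤ 2 * 3 ^ C n) (sym n≡2*m)
             (3*[2*m]≤2*3^C 0<m (proj₂ (rec (subst (m <_) (sym n≡2*m) (m<p*m prime[2] 0<m)) 0<m)))
  step 1 _ _ | no 2∤1 = ⊥-elim ∘ 2∤1 , ≤-refl
  step n@(2+ _) rec _ | no 2∤n with prime-factor n (s≤s (s≤s z≤n))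
  ... | p , m , p-prime , 0<m , n≡p*m = ⊥-elim ∘ 2∤n ,
    subst (λ n → n ≤ 3 ^ C n) (sym n≡p*m) (p*m≤3^C p-prime p≢2 0<m bound-p-1 bound-m)
    where
    p≢2 : p ≢ 2
    p≢2 refl = 2∤n (subst (2 ∣_) (sym n≡p*m) (m∣m*n m))
    p≤n : p ≤ n
    p≤n = subst (p ≤_) (sym n≡p*m) (m≤m*n p m {{>-nonZero 0<m}})
    bound-p-1 : 3 * (p ∸ 1) ≤ 2 * 3 ^ C (p ∸ 1)
    bound-p-1 = proj₁ (rec (<-≤-trans (∸-monoʳ-< z<s (prime⇒0< p-prime)) p≤n)
                           (∸-monoˡ-< (prime⇒1< p-prime) ≤-refl))
                      (2∤⇒2∣pred (prime≢2⇒2∤ p-prime p≢2))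
    bound-m : m ≤ 3 ^ C m
    bound-m = proj₂ (rec (subst (m <_) (sym n≡p*m) (m<p*m p-prime 0<m)) 0<m)

3*pred≤2*3^C : ∀ {p} → Prime p → p ≢ 2 → 3 * (p ∸ 1) ≤ 2 * 3 ^ C (p ∸ 1)
3*pred≤2*3^C p-prime p≢2 =
  proj₁ (3^C-bounds _ (∸-monoˡ-< (prime⇒1< p-prime) ≤-refl)) (2∤⇒2∣pred (prime≢2⇒2∤ p-prime p≢2))

H-*-odd-primes : ∀ {p q} → Prime p → Prime q → p ≢ 2 → q ≢ 2 → H (p * q) ≡ suc (C (p ∸ 1) + C (q ∸ 1))
H-*-odd-primes {p} {q} p-prime q-prime p≢2 q≢2 = begin
  H (p * q)                   ≡⟨ C+[odd>1]≡H (p * q) ⟨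
  C (p * q) + [odd>1] (p * q) ≡⟨ cong₂ _+_ (C-* p q (prime⇒0< p-prime) (prime⇒0< q-prime)) pq-odd ⟩
  C p + C q + 1               ≡⟨ +-comm (C p + C q) 1 ⟩
  suc (C p + C q)             ≡⟨ cong suc (cong₂ _+_ (C-odd-prime p-prime p≢2) (C-odd-prime q-prime q≢2)) ⟩
  suc (C (p ∸ 1) + C (q ∸ 1)) ∎
  where
  open ≡-Reasoning
  pq-odd : [odd>1] (p * q) ≡ 1
  pq-odd = [odd>1]-odd (1<p*m (prime⇒0< p-prime) (prime⇒1< q-prime))
                       (2∤* (prime≢2⇒2∤ p-prime p≢2) (prime≢2⇒2∤ q-prime q≢2))

3*≤2*3^⇒exponent : ∀ {x} a → 3 < x → 3 * x ≤ 2 * 3 ^ a → ∃[ c ] a ≡ 2 + c × x ≤ 6 * 3 ^ c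
3*≤2*3^⇒exponent 0 3<x 3x≤2 = contradiction (≤-trans (*-monoʳ-≤ 3 3<x) 3x≤2) (from-no (12 ≤? 2))
3*≤2*3^⇒exponent 1 3<x 3x≤6 = contradiction (≤-trans (*-monoʳ-≤ 3 3<x) 3x≤6) (from-no (12 ≤? 6))
3*≤2*3^⇒exponent (2+ c) _ 3x≤18*3^c = c , refl , *-cancelˡ-≤ 3 (≤-trans 3x≤18*3^c (≤-reflexive (18*y≡3*[6*y] (3 ^ c))))
  where
  18*y≡3*[6*y] : ∀ y → 2 * (3 * (3 * y)) ≡ 3 * (6 * y)
  18*y≡3*[6*y] = solve-∀

[1+6X][1+6Y]≤54XY : ∀ {X Y} → 0 < X → 0 < Y → suc (6 * X) * suc (6 * Y) ≤ 2 * (3 * (X * (3 * (3 * Y))))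
[1+6X][1+6Y]≤54XY {suc x} {suc y} _ _ = ≤-trans (m≤m+n _ _) (≤-reflexive (sym (expand x y)))
  where
  expand : ∀ x y → 2 * (3 * (suc x * (3 * (3 * suc y)))) ≡
                   suc (6 * suc x) * suc (6 * suc y) + (5 + 12 * x + 12 * y + 18 * (x * y))
  expand = solve-∀

*<2*3^+1 : ∀ {p q} a b → 4 < p → 4 < q → 3 * (p ∸ 1) ≤ 2 * 3 ^ a → 3 * (q ∸ 1) ≤ 2 * 3 ^ b →
           p * q < 2 * 3 ^ (a + b ∸ 1) + 1
*<2*3^+1 {suc x} {suc y} a b (s≤s 3<x) (s≤s 3<y) 3x≤ 3y≤
  with c , refl , x≤6*3^c ← 3*≤2*3^⇒exponent a 3<x 3x≤
     | d , refl , y≤6*3^d ← 3*≤2*3^⇒exponent b 3<y 3y≤ = begin-strict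
  suc x * suc y                                 ≤⟨ *-mono-≤ (s≤s x≤6*3^c) (s≤s y≤6*3^d) ⟩
  suc (6 * 3 ^ c) * suc (6 * 3 ^ d)             ≤⟨ [1+6X][1+6Y]≤54XY (m^n>0 3 c) (m^n>0 3 d) ⟩
  2 * (3 * (3 ^ c * (3 * (3 * 3 ^ d))))         ≡⟨ cong (λ z → 2 * (3 * z)) (^-distribˡ-+-* 3 c (2 + d)) ⟨
  2 * 3 ^ (2 + c + (2 + d) ∸ 1)                 <⟨ m<m+n _ z<s ⟩
  2 * 3 ^ (2 + c + (2 + d) ∸ 1) + 1             ∎
  where open ≤-Reasoning

lemma3p2 : (k p q : ℕ) → 2 < k → Prime p → Prime q → p ≢ 2 → p ≢ 3 → q ≢ 2 → q ≢ 3 → H (p * q) ≡ k → p * q < 2 * 3 ^ (k ∸ 2) + 1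
lemma3p2 k p q _ p-prime q-prime p≢2 p≢3 q≢2 q≢3 H[pq]≡k =
  subst (λ k → p * q < 2 * 3 ^ (k ∸ 2) + 1) (trans (sym (H-*-odd-primes p-prime q-prime p≢2 q≢2)) H[pq]≡k)
    (*<2*3^+1 (C (p ∸ 1)) (C (q ∸ 1))
      (prime≢2,3⇒4< p-prime p≢2 p≢3) (prime≢2,3⇒4< q-prime q≢2 q≢3)
      (3*pred≤2*3^C p-prime p≢2) (3*pred≤2*3^C q-prime q≢2))
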